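{- Let $q$ be an indeterminate. Define $C_n^*(a,b,q)$ for indeterminates $a,b$ by $C_0^*=1$ and $C_n^*(a,b,q)=a\,C_{n-1}^*(a,b,q)+b\sum_{k=0}^{n-2}q^kC_k^*(a,b,q)C_{n-1-k}^*(a,b,q)$ for $n\ge1$, and define the $q$-Catalan numbers $C_n(q)$ by $C_0(q)=1$ and $C_n(q)=\sum_{k=0}^{n-1}q^kC_k(q)C_{n-k-1}(q)$ for $n\ge1$. Then for all $n\ge0$, $$C^*_{2n+1}(1,-1,q)=(-1)^n q^n C_n(q^2)\qquad\text{and}\qquad C^*_{2n+2}(1,-1,q)=0.$$
   Context: $C_n(q^2)$ denotes $C_n(q)$ with $q$ replaced by $q^2$. -}

module Defs where

open import Algebra.Bundles using (CommutativeRing)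
open import Data.Nat using (ℕ; zero; suc; _∸_; _≤ᵇ_)
open import Data.Bool using (if_then_else_)

-- All definitions are generic over a commutative ring R; the element q of R
-- plays the role of the indeterminate (taking R = ℤ[q] recovers the paper).
module _ {c ℓ} (R : CommutativeRing c ℓ) where
  open CommutativeRing R

  pow : Carrier → ℕ → Carrier
  pow x zero    = 1#
  pow x (suc k) = pow x k * x

  sumTo : ℕ → (ℕ → Carrier) → Carrier
  sumTo zero    f = 0#
  sumTo (suc m) f = sumTo m f + f m

  -- CstarTable a b q m i = C*_i(a,b,q) for i ≤ m  (junk for i > m).
  -- C*_0 = 1,  C*_{m+1} = a C*_m + b Σ_{k=0}^{m-1} q^k C*_k C*_{m-k}.
  CstarTable : Carrier → Carrier → Carrier → ℕ → ℕ → Carrier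
  CstarTable a b q zero    i = 1#
  CstarTable a b q (suc m) i =
    if i ≤ᵇ m then T i
    else (a * T m + b * sumTo m (λ k → pow q k * (T k * T (m ∸ k))))
    where
    T : ℕ → Carrier
    T = CstarTable a b q m

  Cstar : Carrier → Carrier → Carrier → ℕ → Carrier
  Cstar a b q n = CstarTable a b q n n

  qCatTable : Carrier → ℕ → ℕ → Carrier
  qCatTable q zero    i = 1#
  qCatTable q (suc m) i =
    if i ≤ᵇ m then T i
    else sumTo (suc m) (λ k → pow q k * (T k * T (m ∸ k)))
    where
    T : ℕ → Carrier
    T = qCatTable q m

  qCat : Carrier → ℕ → Carrier
  qCat q n = qCatTable q n n

{-# OPTIONS --safe #-}
module Submission where

-- Write C*ₙ for C*ₙ(1,-1,q), so that C*ₘ₊₁ = C*ₘ - Σ_{k<m} qᵏ C*ₖ C*ₘ₋ₖ, and prove both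
-- claims together by strong induction on n.  For m = 2n+1 the indices k and m-k have
-- opposite parity, so every summand with k ≥ 1 contains a factor C*₂ᵢ with i ≥ 1, which
-- vanishes; the k = 0 summand is C*ₘ itself, hence C*₂ₙ₊₂ = 0.  For m = 2n+2 the summands
-- with k even vanish likewise, while k = 2j+1 gives
-- q²ʲ⁺¹ (-1)ʲ qʲ Cⱼ(q²) (-1)ⁿ⁻ʲ qⁿ⁻ʲ Cₙ₋ⱼ(q²) = (-1)ⁿ qⁿ⁺¹ (q²)ʲ Cⱼ(q²) Cₙ₋ⱼ(q²),
-- and these add up to (-1)ⁿ qⁿ⁺¹ Cₙ₊₁(q²) by the recurrence of the q-Catalan numbers.

open import Defs
open import Level using (Level)
open import Algebra.Bundles using (CommutativeRing)
open import Data.Bool using (Bool; true; false; if_then_else_; T)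
open import Data.Nat as ℕ using (ℕ; zero; suc; _∸_; _≤ᵇ_; z≤n; s≤s; z<s)
open import Data.Nat.Induction using (<-rec)
open import Data.Nat.Properties
  using ( ≤⇒≤ᵇ; ≤ᵇ⇒≤; n≮n; ≤-pred; <⇒≤; m<n⇒m<1+n; n<1+n; m≤n⇒m<n∨m≡n
        ; m∸n≤m; ∸-monoʳ-<; m+[n∸m]≡n; +-suc)
open import Data.Product using (_×_; _,_; proj₁; proj₂)
open import Data.Sum using (inj₁; inj₂)
open import Function using (_∘_)
open import Relation.Nullary using (¬_; contradiction)
open import Relation.Binary.PropositionalEquality as ≡ using (_≡_)

if-T : ∀ {a} {A : Set a} {b : Bool} {x y : A} → T b → (if b then x else y) ≡ x
if-T {b = true} _ = ≡.refl

if-¬T : ∀ {a} {A : Set a} {b : Bool} {x y : A} → ¬ T b → (if b then x else y) ≡ y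
if-¬T {b = false} _  = ≡.refl
if-¬T {b = true}  ¬t = contradiction _ ¬t

module MemoTable {a} {A : Set a} (t : ℕ → ℕ → A) (next : ℕ → (ℕ → A) → A)
  (t-suc : ∀ m i → t (suc m) i ≡ (if i ≤ᵇ m then t m i else next m (t m))) where

  stable : ∀ {m i} → i ℕ.≤ m → t m i ≡ t i i
  stable {zero} z≤n = ≡.refl
  stable {suc m} {i} i≤1+m with m≤n⇒m<n∨m≡n i≤1+m
  ... | inj₁ (s≤s i≤m) = ≡.trans (≡.trans (t-suc m i) (if-T (≤⇒≤ᵇ i≤m))) (stable i≤m)
  ... | inj₂ ≡.refl    = ≡.refl

  diagonal-suc : ∀ m → t (suc m) (suc m) ≡ next m (t m)
  diagonal-suc m = ≡.trans (t-suc m (suc m)) (if-¬T (n≮n m ∘ ≤ᵇ⇒≤ (suc m) m))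

double : ℕ → ℕ
double zero    = zero
double (suc n) = suc (suc (double n))

double≡n+n : ∀ n → double n ≡ n ℕ.+ n
double≡n+n zero    = ≡.refl
double≡n+n (suc n) = ≡.cong suc (≡.trans (≡.cong suc (double≡n+n n)) (≡.sym (+-suc n n)))

suc-double-∸-double : ∀ {j n} → j ℕ.≤ n → suc (double n) ∸ double j ≡ suc (double (n ∸ j))
suc-double-∸-double z≤n       = ≡.refl
suc-double-∸-double (s≤s j≤n) = suc-double-∸-double j≤n

double-∸-double : ∀ {j n} → j ℕ.< n → double n ∸ double j ≡ double (suc (n ∸ suc j))
double-∸-double {zero}  (s≤s z≤n) = ≡.refl
double-∸-double {suc j} (s≤s j<n) = double-∸-double j<n

module _ {r ℓ} (R : CommutativeRing r ℓ) where
  open CommutativeRing R hiding (zero)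
  open import Algebra.Properties.Ring ring using (-1*x≈-x; -0#≈0#)
  open import Algebra.Solver.CommutativeMonoid *-commutativeMonoid using (solve; _⊕_; _⊜_)
  open import Relation.Binary.Reasoning.Setoid setoid

  sumTo-cong : ∀ m {f g : ℕ → Carrier} → (∀ {k} → k ℕ.< m → f k ≈ g k) →
    sumTo R m f ≈ sumTo R m g
  sumTo-cong zero    f≈g = refl
  sumTo-cong (suc m) f≈g = +-cong (sumTo-cong m (f≈g ∘ m<n⇒m<1+n)) (f≈g (n<1+n m))

  sumTo-zero : ∀ m {f : ℕ → Carrier} → (∀ {k} → k ℕ.< m → f k ≈ 0#) → sumTo R m f ≈ 0#
  sumTo-zero zero    f≈0 = refl
  sumTo-zero (suc m) f≈0 =
    trans (+-cong (sumTo-zero m (f≈0 ∘ m<n⇒m<1+n)) (f≈0 (n<1+n m))) (+-identityˡ 0#)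

  *-distribˡ-sumTo : ∀ x m (f : ℕ → Carrier) → x * sumTo R m f ≈ sumTo R m (λ k → x * f k)
  *-distribˡ-sumTo x zero    f = zeroʳ x
  *-distribˡ-sumTo x (suc m) f = trans (distribˡ x _ _) (+-cong (*-distribˡ-sumTo x m f) refl)

  sumTo-sucˡ : ∀ m (f : ℕ → Carrier) → sumTo R (suc m) f ≈ f 0 + sumTo R m (f ∘ suc)
  sumTo-sucˡ zero    f = trans (+-identityˡ _) (sym (+-identityʳ _))
  sumTo-sucˡ (suc m) f = trans (+-cong (sumTo-sucˡ m f) refl) (+-assoc _ _ _)

  sumTo-double : ∀ n (f : ℕ → Carrier) →
    sumTo R (double n) f ≈ sumTo R n (λ j → f (double j) + f (suc (double j)))
  sumTo-double zero    f = refl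
  sumTo-double (suc n) f = trans (+-assoc _ _ _) (+-cong (sumTo-double n f) refl)

  pow-+ : ∀ x i j → pow R x (i ℕ.+ j) ≈ pow R x i * pow R x j
  pow-+ x zero    j = sym (*-identityˡ _)
  pow-+ x (suc i) j = trans (*-cong (pow-+ x i j) refl)
    (solve 3 (λ a b c → (a ⊕ b) ⊕ c ⊜ (a ⊕ c) ⊕ b) refl (pow R x i) (pow R x j) x)

  pow-∸ : ∀ x {i n} → i ℕ.≤ n → pow R x i * pow R x (n ∸ i) ≈ pow R x n
  pow-∸ x {i} {n} i≤n =
    trans (sym (pow-+ x i (n ∸ i))) (reflexive (≡.cong (pow R x) (m+[n∸m]≡n i≤n)))

  pow-double : ∀ x j → pow R x (double j) ≈ pow R (x * x) j
  pow-double x zero    = refl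
  pow-double x (suc j) = trans (*-assoc _ _ _) (*-cong (pow-double x j) refl)

  qSummand : Carrier → (ℕ → Carrier) → ℕ → ℕ → Carrier
  qSummand q f m k = pow R q k * (f k * f (m ∸ k))

  qSummand-cong : ∀ q {f g : ℕ → Carrier} {m} → (∀ {i} → i ℕ.≤ m → f i ≈ g i) →
    ∀ {k} → k ℕ.≤ m → qSummand q f m k ≈ qSummand q g m k
  qSummand-cong q {m = m} f≈g {k} k≤m = *-cong refl (*-cong (f≈g k≤m) (f≈g (m∸n≤m m k)))

  Cstar-suc : ∀ a b q m →
    Cstar R a b q (suc m) ≈ a * Cstar R a b q m + b * sumTo R m (qSummand q (Cstar R a b q) m)
  Cstar-suc a b q m = trans (reflexive (diagonal-suc m))
    (+-cong refl (*-cong refl (sumTo-cong m (qSummand-cong q (reflexive ∘ stable) ∘ <⇒≤))))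
    where
    open MemoTable (CstarTable R a b q)
      (λ m T → a * T m + b * sumTo R m (qSummand q T m)) (λ _ _ → ≡.refl)

  qCat-suc : ∀ q m → qCat R q (suc m) ≈ sumTo R (suc m) (qSummand q (qCat R q) m)
  qCat-suc q m = trans (reflexive (diagonal-suc m))
    (sumTo-cong (suc m) (qSummand-cong q (reflexive ∘ stable) ∘ ≤-pred))
    where
    open MemoTable (qCatTable R q) (λ m T → sumTo R (suc m) (qSummand q T m)) (λ _ _ → ≡.refl)

  module _ (q : Carrier) where

    C* : ℕ → Carrier
    C* = Cstar R 1# (- 1#) q

    Cq² : ℕ → Carrier
    Cq² = qCat R (q * q)

    signedCat : ℕ → Carrier
    signedCat n = pow R (- 1#) n * pow R q n * Cq² n

    C*-suc : ∀ m → C* (suc m) ≈ C* m - sumTo R m (qSummand q C* m)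
    C*-suc m = trans (Cstar-suc 1# (- 1#) q m) (+-cong (*-identityˡ _) (-1*x≈-x _))

    qSummand-vanishesˡ : ∀ m k → C* k ≈ 0# → qSummand q C* m k ≈ 0#
    qSummand-vanishesˡ m k C*k≈0 =
      trans (*-cong refl (trans (*-cong C*k≈0 refl) (zeroˡ _))) (zeroʳ _)

    qSummand-vanishesʳ : ∀ m k → C* (m ∸ k) ≈ 0# → qSummand q C* m k ≈ 0#
    qSummand-vanishesʳ m k C*m∸k≈0 =
      trans (*-cong refl (trans (*-cong refl C*m∸k≈0) (zeroʳ _))) (zeroʳ _)

    signedCat-* : ∀ {j n} → j ℕ.≤ n →
      signedCat j * signedCat (n ∸ j) ≈ pow R (- 1#) n * pow R q n * (Cq² j * Cq² (n ∸ j))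
    signedCat-* {j} {n} j≤n = begin
      signedCat j * signedCat (n ∸ j)
        ≈⟨ solve 6 (λ sj qj cj sk qk ck →
                      ((sj ⊕ qj) ⊕ cj) ⊕ ((sk ⊕ qk) ⊕ ck) ⊜ ((sj ⊕ sk) ⊕ (qj ⊕ qk)) ⊕ (cj ⊕ ck))
             refl (pow R (- 1#) j) (pow R q j) (Cq² j)
                  (pow R (- 1#) (n ∸ j)) (pow R q (n ∸ j)) (Cq² (n ∸ j)) ⟩
      (pow R (- 1#) j * pow R (- 1#) (n ∸ j)) * (pow R q j * pow R q (n ∸ j)) * (Cq² j * Cq² (n ∸ j))
        ≈⟨ *-cong (*-cong (pow-∸ (- 1#) j≤n) (pow-∸ q j≤n)) refl ⟩
      pow R (- 1#) n * pow R q n * (Cq² j * Cq² (n ∸ j)) ∎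

    OddEven : ℕ → Set ℓ
    OddEven n = (C* (suc (double n)) ≈ signedCat n) × (C* (double (suc n)) ≈ 0#)

    OddEvenBelow : ℕ → Set ℓ
    OddEvenBelow n = ∀ {j} → j ℕ.< n → OddEven j

    qSummand-pair≈0 : ∀ {n j} → OddEvenBelow n → j ℕ.< n →
      qSummand q C* (suc (double n)) (suc (double j)) + qSummand q C* (suc (double n)) (double (suc j)) ≈ 0#
    qSummand-pair≈0 {n} {j} below j<n = trans
      (+-cong (qSummand-vanishesʳ m (suc (double j))
                (trans (reflexive (≡.cong C* (double-∸-double j<n)))
                       (proj₂ (below (∸-monoʳ-< z<s j<n)))))
              (qSummand-vanishesˡ m (double (suc j)) (proj₂ (below j<n))))
      (+-identityʳ 0#)
      where
      m : ℕ
      m = suc (double n)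

    C*-even : ∀ n → OddEvenBelow n → C* (double (suc n)) ≈ 0#
    C*-even n below = begin
      C* (suc m)                          ≈⟨ C*-suc m ⟩
      C* m - sumTo R m (qSummand q C* m)  ≈⟨ +-cong refl (-‿cong sum≈C*m) ⟩
      C* m - C* m                         ≈⟨ -‿inverseʳ (C* m) ⟩
      0#                                  ∎
      where
      m : ℕ
      m = suc (double n)
      sum≈C*m : sumTo R m (qSummand q C* m) ≈ C* m
      sum≈C*m = begin
        sumTo R m (qSummand q C* m)
          ≈⟨ sumTo-sucˡ (double n) _ ⟩
        qSummand q C* m 0 + sumTo R (double n) (qSummand q C* m ∘ suc)
          ≈⟨ +-cong refl (trans (sumTo-double n _) (sumTo-zero n (qSummand-pair≈0 below))) ⟩
        1# * (1# * C* m) + 0#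
          ≈⟨ trans (+-identityʳ _) (trans (*-identityˡ _) (*-identityˡ _)) ⟩
        C* m ∎

    qSummand-double≈0 : ∀ {n j} → OddEvenBelow (suc n) → j ℕ.< suc n →
      qSummand q C* (double (suc n)) (double j) ≈ 0#
    qSummand-double≈0 {n} {zero} below _ =
      qSummand-vanishesʳ (double (suc n)) 0 (proj₂ (below (n<1+n n)))
    qSummand-double≈0 {n} {suc j} below (s≤s j<n) =
      qSummand-vanishesˡ (double (suc n)) (double (suc j)) (proj₂ (below (m<n⇒m<1+n j<n)))

    qSummand-suc-double : ∀ {n j} → OddEvenBelow (suc n) → j ℕ.≤ n →
      qSummand q C* (double (suc n)) (suc (double j))
        ≈ (pow R (- 1#) n * pow R q n * q) * qSummand (q * q) Cq² n j
    qSummand-suc-double {n} {j} below j≤n = begin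
      pow R q (suc (double j)) * (C* (suc (double j)) * C* (double (suc n) ∸ suc (double j)))
        ≈⟨ *-cong (*-cong (pow-double q j) refl)
                  (*-cong (proj₁ (below (s≤s j≤n)))
                          (trans (reflexive (≡.cong C* (suc-double-∸-double j≤n)))
                                 (proj₁ (below (s≤s (m∸n≤m n j)))))) ⟩
      (pow R (q * q) j * q) * (signedCat j * signedCat (n ∸ j))
        ≈⟨ *-cong refl (signedCat-* j≤n) ⟩
      (pow R (q * q) j * q) * (pow R (- 1#) n * pow R q n * (Cq² j * Cq² (n ∸ j)))
        ≈⟨ solve 5 (λ Qj q′ sn qn cc →
                      (Qj ⊕ q′) ⊕ ((sn ⊕ qn) ⊕ cc) ⊜ ((sn ⊕ qn) ⊕ q′) ⊕ (Qj ⊕ cc))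
             refl (pow R (q * q) j) q (pow R (- 1#) n) (pow R q n) (Cq² j * Cq² (n ∸ j)) ⟩
      (pow R (- 1#) n * pow R q n * q) * qSummand (q * q) Cq² n j ∎

    C*-odd : ∀ n → OddEvenBelow n → C* (suc (double n)) ≈ signedCat n
    C*-odd zero _ = begin
      C* 1         ≈⟨ C*-suc 0 ⟩
      1# - 0#      ≈⟨ trans (+-cong refl -0#≈0#) (+-identityʳ 1#) ⟩
      1#           ≈⟨ sym (trans (*-identityʳ _) (*-identityʳ 1#)) ⟩
      1# * 1# * 1# ∎
    C*-odd (suc n) below = begin
      C* (suc m)                          ≈⟨ C*-suc m ⟩
      C* m - sumTo R m (qSummand q C* m)  ≈⟨ +-cong (proj₂ (below (n<1+n n))) (-‿cong sum≈) ⟩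
      0# - c * Cq² (suc n)                ≈⟨ trans (+-identityˡ _) (sym (-1*x≈-x _)) ⟩
      - 1# * (c * Cq² (suc n))
        ≈⟨ solve 5 (λ s sn qn q′ C →
                      s ⊕ (((sn ⊕ qn) ⊕ q′) ⊕ C) ⊜ ((sn ⊕ s) ⊕ (qn ⊕ q′)) ⊕ C)
             refl (- 1#) (pow R (- 1#) n) (pow R q n) q (Cq² (suc n)) ⟩
      signedCat (suc n) ∎
      where
      m : ℕ
      m = double (suc n)
      c : Carrier
      c = pow R (- 1#) n * pow R q n * q
      pair≈ : ∀ {j} → j ℕ.< suc n →
        qSummand q C* m (double j) + qSummand q C* m (suc (double j)) ≈ c * qSummand (q * q) Cq² n j
      pair≈ j<1+n = trans
        (+-cong (qSummand-double≈0 below j<1+n) (qSummand-suc-double below (≤-pred j<1+n)))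
        (+-identityˡ _)
      sum≈ : sumTo R m (qSummand q C* m) ≈ c * Cq² (suc n)
      sum≈ = begin
        sumTo R m (qSummand q C* m)                           ≈⟨ sumTo-double (suc n) _ ⟩
        sumTo R (suc n) (λ j → qSummand q C* m (double j) + qSummand q C* m (suc (double j)))
                                                              ≈⟨ sumTo-cong (suc n) pair≈ ⟩
        sumTo R (suc n) (λ j → c * qSummand (q * q) Cq² n j)  ≈⟨ sym (*-distribˡ-sumTo c (suc n) _) ⟩
        c * sumTo R (suc n) (qSummand (q * q) Cq² n)          ≈⟨ *-cong refl (sym (qCat-suc (q * q) n)) ⟩
        c * Cq² (suc n)                                       ∎

    oddEven : ∀ n → OddEven n
    oddEven = <-rec OddEven (λ n below → C*-odd n below , C*-even n below)

mainTheorem5 : ∀ {c ℓ : Level} (R : CommutativeRing c ℓ) →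
    let open CommutativeRing R in
    (q : Carrier) (n : ℕ) →
      (Cstar R 1# (- 1#) q (suc (n ℕ.+ n)) ≈ pow R (- 1#) n * pow R q n * qCat R (q * q) n)
      × (Cstar R 1# (- 1#) q (suc (suc (n ℕ.+ n))) ≈ 0#)
mainTheorem5 R q n rewrite ≡.sym (double≡n+n n) = oddEven R q n
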